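{- Let $2\le k<\omega$ and write $\mathbb A$ for $\mathbb A_k$. Let $\xi<\varepsilon_0$ be a successor ordinal such that $m=\mathbb A(\xi)$ is in normal form, with normal form sequence $\xi_0,\dots,\xi_n$ (so $\xi_n=\xi$ and $n\ge1$), and let $\xi^-=\xi_{n-1}$. Then either (a) $\mathbb A(\xi-1)$ is in normal form, or (b) $\xi=\alpha+\mathbb A(\xi^-)$, where $\alpha$ is a limit ordinal or zero and $\mathrm{mc}(\alpha)<\mathbb A(\xi^-)$.
   Context: Ordinals: $\varepsilon_0$ is the least ordinal $\varepsilon$ with $\omega^\varepsilon=\varepsilon$. Every $0<\xi<\varepsilon_0$ has a unique $\omega$-normal form $\xi=\omega^{\alpha}b+\gamma$ with $\alpha<\xi$, $b$ a positive natural number, $\gamma<\omega^\alpha$. $\mathrm{coeffs}(0)=\{0\}$, $\mathrm{coeffs}(\omega^\alpha b+\gamma)=\mathrm{coeffs}(\alpha)\cup\mathrm{coeffs}(\gamma)\cup\{b\}$, $\mathrm{mc}(\xi)=\max\mathrm{coeffs}(\xi)$. Fundamental sequences: $0[n]=1[n]=0$; $(\omega^\alpha b+\gamma)[n]=\omega^\alpha b+\gamma[n]$ if $\gamma>0$; $\omega^{\alpha+1}[n]=\omega^\alpha n$; $(\omega^\alpha(b+1))[n]=\omega^\alpha b+(\omega^\alpha)[n]$ if $b>0$; $(\omega^\alpha)[n]=\omega^{\alpha[n]}$ if $\alpha$ is a limit. For $2\le k<\omega$, $\mathbb A_k:\varepsilon_0\to\mathbb N$: $\mathbb A_k(\xi)=\xi+1$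 if $\xi<\omega$; if $\xi\ge\omega$, write $\xi=\alpha+b$ with $\alpha$ a limit, $b<\omega$; $\mathbb A_k^{(0)}(\xi)=\mathbb A_k(\xi-1)$ if $b>0$, $=\mathrm{mc}(\xi)$ if $b=0$; $\mathbb A_k^{(i+1)}(\xi)=\mathbb A_k(\alpha[\mathbb A_k^{(i)}(\xi)])$; $\mathbb A_k(\xi)=\mathbb A_k^{(k)}(\xi)$. $k$-normal forms: for a positive integer $m$ and $\xi<\varepsilon_0$, $\mathbb A_k(\xi)$ is the $k$-normal form of $m$ if $m=\mathbb A_k(\xi)$ and there is a sequence $\xi_0,\dots,\xi_n<\varepsilon_0$ (a normal form sequence) with $\xi_0=0$, $\xi_n=\xi$, and for each $i<n$, $\xi_{i+1}$ is the maximum $\zeta<\varepsilon_0$ with $\mathbb A_k(\zeta)\le m$ and $\mathrm{mc}(\zeta)\ge\mathbb A_k(\xi_i)$ if such a maximum exists, $\xi_{i+1}=0$ otherwise. "$\mathbb A_k(\xi)$ is in normal form" means that $\mathbb A_k(\xi)$ is the $k$-normal form of the number $\mathbb A_k(\xi)$. -}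

module Defs where

open import Data.Nat using (ℕ; zero; suc; _≤_; _<_; _⊔_; _∸_)
open import Data.Product using (_×_; _,_; ∃; Σ)
open import Data.Sum using (_⊎_)
open import Relation.Binary.PropositionalEquality using (_≡_; _≢_)
open import Relation.Nullary using (¬_)

-- A term denotes an ordinal < ε₀
-- exactly when it satisfies WF (b ≥ 1, γ < ω^α, subterms WF); the
-- ω-normal form is unique, so ordinals < ε₀ are in bijection with WF terms
-- and ordinal equality is syntactic equality of WF terms.

data OT : Set where
  𝟎 : OT
  ω^_·_+_ : OT → ℕ → OT → OT

infixr 30 ω^_·_+_
infix 4 _<ₒ_ _≤ₒ_
infixl 40 _[_]

-- the ordinal order (correct on WF terms: lexicographic on CNF)
data _<ₒ_ : OT → OT → Set where
  z<ω : ∀ {a b c} → 𝟎 <ₒ ω^ a · b + c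
  exp< : ∀ {a b c a' b' c'} → a <ₒ a' → ω^ a · b + c <ₒ ω^ a' · b' + c'
  coef< : ∀ {a b c b' c'} → b < b' → ω^ a · b + c <ₒ ω^ a · b' + c'
  rest< : ∀ {a b c c'} → c <ₒ c' → ω^ a · b + c <ₒ ω^ a · b + c'

_≤ₒ_ : OT → OT → Set
x ≤ₒ y = (x <ₒ y) ⊎ (x ≡ y)

data WF : OT → Set where
  wf𝟎 : WF 𝟎
  wfω : ∀ {a b c} → WF a → 1 ≤ b → WF c → c <ₒ ω^ a · 1 + 𝟎 → WF (ω^ a · b + c)

mc : OT → ℕ
mc 𝟎 = 0
mc (ω^ a · b + c) = mc a ⊔ (b ⊔ mc c)

-- append a term t < (last exponent) at the end of a normal form
app : OT → OT → OT
app 𝟎 t = t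
app (ω^ a · b + c) t = ω^ a · b + app c t

-- α + n for α a limit or zero and n < ω
addFin : OT → ℕ → OT
addFin l zero = l
addFin l (suc n) = app l (ω^ 𝟎 · suc n + 𝟎)

-- split ξ = (α , b) with ξ = α + b, α a limit or zero, b < ω
split : OT → Σ OT (λ _ → ℕ)
split 𝟎 = 𝟎 , 0
split (ω^ 𝟎 · b + c) = 𝟎 , b
split (ω^ (ω^ x · y + z) · b + c) with split c
... | l , n = ω^ (ω^ x · y + z) · b + l , n

finPart : OT → ℕ
finPart ξ with split ξ
... | _ , n = n

limPart : OT → OT
limPart ξ with split ξ
... | l , _ = l

IsSucc : OT → Set
IsSucc ξ = finPart ξ ≢ 0

IsLimOrZero : OT → Set
IsLimOrZero ξ = finPart ξ ≡ 0

pred₀ : OT → OT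
pred₀ ξ = addFin (limPart ξ) (finPart ξ ∸ 1)

ωmul : OT → ℕ → OT
ωmul e zero = 𝟎
ωmul e (suc n) = ω^ e · suc n + 𝟎

mutual
  _[_] : OT → ℕ → OT
  𝟎 [ n ] = 𝟎
  (ω^ a · b + (ω^ x · y + z)) [ n ] = ω^ a · b + ((ω^ x · y + z) [ n ])
  (ω^ a · zero + 𝟎) [ n ] = 𝟎
  (ω^ a · suc zero + 𝟎) [ n ] = fsω a n
  (ω^ a · suc (suc b) + 𝟎) [ n ] = ω^ a · suc b + fsω a n

  fsω : OT → ℕ → OT
  fsω 𝟎 n = 𝟎
  fsω (ω^ x · y + z) n = fsωh (split (ω^ x · y + z)) ((ω^ x · y + z) [ n ]) n

  fsωh : Σ OT (λ _ → ℕ) → OT → ℕ → OT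
  fsωh (l , zero) a[n] n = ω^ a[n] · 1 + 𝟎          -- exponent a limit: ω^(a[n])
  fsωh (l , suc j) a[n] n = ωmul (addFin l j) n      -- exponent a = a'+1: ω^a'·n

-- The functions 𝔸_k, given by their (deterministic) graphs:
--   A k ξ m     means  𝔸_k(ξ) = m
--   Ait k ξ i m means  𝔸_k^{(i)}(ξ) = m   (for ξ ≥ ω)

mutual
  data A (k : ℕ) : OT → ℕ → Set where
    A-fin : ∀ {ξ v} → split ξ ≡ (𝟎 , v) → A k ξ (suc v)
    A-inf : ∀ {ξ α b m} → split ξ ≡ (α , b) → α ≢ 𝟎 → Ait k ξ k m → A k ξ m

  data Ait (k : ℕ) : OT → ℕ → ℕ → Set where
    it0-succ : ∀ {ξ α b m} → split ξ ≡ (α , suc b) → A k (addFin α b) m → Ait k ξ 0 m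
    it0-lim : ∀ {ξ α} → split ξ ≡ (α , 0) → Ait k ξ 0 (mc ξ)
    it-suc : ∀ {ξ α b i m' m} → split ξ ≡ (α , b) → Ait k ξ i m' → A k (α [ m' ]) m → Ait k ξ (suc i) m

Cand : ℕ → ℕ → ℕ → OT → Set
Cand k m a ζ = WF ζ × (∃ λ v → A k ζ v × v ≤ m) × a ≤ mc ζ

IsMax : (OT → Set) → OT → Set
IsMax P y = P y × (∀ z → P z → z ≤ₒ y)

NFStep : ℕ → ℕ → OT → OT → Set
NFStep k m x y = ∃ λ a → A k x a ×
  (IsMax (Cand k m a) y ⊎ ((¬ ∃ λ z → IsMax (Cand k m a) z) × y ≡ 𝟎))

IsNFSeq : ℕ → ℕ → ℕ → (ℕ → OT) → OT → Set
IsNFSeq k m n seq ξ =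
  seq 0 ≡ 𝟎 × seq n ≡ ξ × (∀ i → i < n → NFStep k m (seq i) (seq (suc i)))

IsNFof : ℕ → ℕ → OT → Set
IsNFof k m ξ = A k ξ m × ∃ λ n → ∃ λ seq → IsNFSeq k m n seq ξ

InNF : ℕ → OT → Set
InNF k ξ = ∃ λ m → IsNFof k m ξ

-- Write ξ = α + (c + 1) and let a = 𝔸(ξ⁻), so that ξ is the largest ζ with
-- 𝔸(ζ) ≤ m and mc(ζ) ≥ a.  Iterating 𝔸 strictly increases values and
-- mc(ζ) < 𝔸(ζ), hence m' = 𝔸(ξ - 1) < m.  If a ≤ mc(ξ - 1), then ξ - 1 is the
-- largest ζ with 𝔸(ζ) ≤ m' and mc(ζ) ≥ a, and the normal form sequence for m
-- (restarted after its last 0) is also one for m', since its values stay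
-- ≤ a < m'; appending ξ - 1 gives the normal form sequence of m'.  Otherwise
-- mc(α) ⊔ c < a ≤ mc(ξ) = mc(α) ⊔ (c + 1), which forces a = c + 1: case (b).
module Submission where

open import Defs
open import Data.Nat using (ℕ; zero; suc; _≤_; _<_; pred; _+_; _∸_; _⊔_; z≤n; s≤s; s≤s⁻¹; _≤?_; _≟_)
open import Data.Nat.Properties
open import Data.Product using (_×_; ∃; ∃₂; Σ; _,_; proj₁; proj₂)
open import Data.Sum using (_⊎_; inj₁; inj₂)
open import Data.Empty using (⊥-elim)
open import Function using (_∘_; case_of_)
open import Relation.Nullary using (¬_; yes; no)
open import Relation.Binary.PropositionalEquality hiding ([_])

-- What remains of WF without the order condition; unlike WF it is preserved by
-- fundamental sequences.
data Shaped : OT → Set where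
  𝟎-shaped : Shaped 𝟎
  ω-shaped : ∀ {a b c} → Shaped a → 1 ≤ b → Shaped c → (a ≡ 𝟎 → c ≡ 𝟎) →
             Shaped (ω^ a · b + c)

-- Terms all of whose exponents are positive: on WF terms, the limits and 0.
data LimTerm : OT → Set where
  𝟎-lim : LimTerm 𝟎
  ω-lim : ∀ {x y z b c} → LimTerm c → LimTerm (ω^ (ω^ x · y + z) · b + c)

<ω^𝟎⇒≡𝟎 : ∀ {c} → WF c → c <ₒ ω^ 𝟎 · 1 + 𝟎 → c ≡ 𝟎
<ω^𝟎⇒≡𝟎 wf𝟎 _ = refl
<ω^𝟎⇒≡𝟎 (wfω _ () _ _) (coef< (s≤s z≤n))
<ω^𝟎⇒≡𝟎 _ (exp< ())
<ω^𝟎⇒≡𝟎 _ (rest< ())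

WF⇒Shaped : ∀ {ζ} → WF ζ → Shaped ζ
WF⇒Shaped wf𝟎 = 𝟎-shaped
WF⇒Shaped (wfω wa b≥1 wc c<ω^a) =
  ω-shaped (WF⇒Shaped wa) b≥1 (WF⇒Shaped wc) (λ { refl → <ω^𝟎⇒≡𝟎 wc c<ω^a })

split₁-LimTerm : ∀ ζ → LimTerm (proj₁ (split ζ))
split₁-LimTerm 𝟎 = 𝟎-lim
split₁-LimTerm (ω^ 𝟎 · b + c) = 𝟎-lim
split₁-LimTerm (ω^ (ω^ x · y + z) · b + c) with split c | split₁-LimTerm c
... | _ , _ | lim = ω-lim lim

split₁-Shaped : ∀ {ζ} → Shaped ζ → Shaped (proj₁ (split ζ))
split₁-Shaped 𝟎-shaped = 𝟎-shaped
split₁-Shaped {ω^ 𝟎 · b + c} _ = 𝟎-shaped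
split₁-Shaped {ω^ (ω^ x · y + z) · b + c} (ω-shaped ga b≥1 gc _) with split c | split₁-Shaped gc
... | _ , _ | gl = ω-shaped ga b≥1 gl λ ()

addFin-split : ∀ {ζ} → Shaped ζ → addFin (proj₁ (split ζ)) (proj₂ (split ζ)) ≡ ζ
addFin-split 𝟎-shaped = refl
addFin-split {ω^ 𝟎 · suc b + c} (ω-shaped _ _ _ c≡𝟎) with c≡𝟎 refl
... | refl = refl
addFin-split {ω^ (ω^ x · y + z) · b + c} (ω-shaped _ _ gc _) with split c | addFin-split gc
... | l , zero  | eq = cong (ω^ (ω^ x · y + z) · b +_) eq
... | l , suc n | eq = cong (ω^ (ω^ x · y + z) · b +_) eq

split-addFin : ∀ {α} j → LimTerm α → split (addFin α j) ≡ (α , j)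
split-addFin zero 𝟎-lim = refl
split-addFin (suc j) 𝟎-lim = refl
split-addFin zero (ω-lim {c = c} lim) with split c | split-addFin zero lim
... | _ | refl = refl
split-addFin (suc j) (ω-lim {c = c} lim) with split (addFin c (suc j)) | split-addFin (suc j) lim
... | _ | refl = refl

split-parts : ∀ {ζ α j} → Shaped ζ → split ζ ≡ (α , j) →
              LimTerm α × Shaped α × addFin α j ≡ ζ
split-parts {ζ} g refl = split₁-LimTerm ζ , split₁-Shaped g , addFin-split g

finPart-split : ∀ ζ → finPart ζ ≡ proj₂ (split ζ)
finPart-split ζ with split ζ
... | _ , _ = refl

limPart-split : ∀ ζ → limPart ζ ≡ proj₁ (split ζ)
limPart-split ζ with split ζ
... | _ , _ = refl

LimTerm⇒IsLimOrZero : ∀ {α} → LimTerm α → IsLimOrZero α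
LimTerm⇒IsLimOrZero {α} lim = trans (finPart-split α) (cong proj₂ (split-addFin 0 lim))

pred₀-addFin : ∀ {α} c → LimTerm α → pred₀ (addFin α (suc c)) ≡ addFin α c
pred₀-addFin {α} c lim = cong₂ addFin
  (trans (limPart-split (addFin α (suc c))) (cong proj₁ (split-addFin (suc c) lim)))
  (cong (_∸ 1) (trans (finPart-split (addFin α (suc c))) (cong proj₂ (split-addFin (suc c) lim))))

succ-decompose : ∀ {ξ} → Shaped ξ → IsSucc ξ →
                 ∃₂ λ α c → LimTerm α × ξ ≡ addFin α (suc c)
succ-decompose {ξ} g ξ-succ with split ξ in eq
... | α , zero  = ⊥-elim (ξ-succ refl)
... | α , suc c with split-parts g eq
...   | lim , _ , ξ≡ = α , c , lim , sym ξ≡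

addFin-cons : ∀ E b l c → addFin (ω^ E · b + l) c ≡ ω^ E · b + addFin l c
addFin-cons E b l zero = refl
addFin-cons E b l (suc c) = refl

Shaped-addFin : ∀ {α} j → LimTerm α → Shaped α → Shaped (addFin α j)
Shaped-addFin zero _ g = g
Shaped-addFin (suc j) 𝟎-lim _ = ω-shaped 𝟎-shaped (s≤s z≤n) 𝟎-shaped (λ _ → refl)
Shaped-addFin (suc j) (ω-lim lim) (ω-shaped ga b≥1 gc _) =
  ω-shaped ga b≥1 (Shaped-addFin (suc j) lim gc) λ ()

mc-addFin : ∀ α j → mc (addFin α j) ≡ mc α ⊔ j
mc-addFin α zero = sym (⊔-identityʳ (mc α))
mc-addFin 𝟎 (suc j) = refl
mc-addFin (ω^ a · b + c) (suc j) = begin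
  mc a ⊔ (b ⊔ mc (addFin c (suc j)))  ≡⟨ cong (λ t → mc a ⊔ (b ⊔ t)) (mc-addFin c (suc j)) ⟩
  mc a ⊔ (b ⊔ (mc c ⊔ suc j))         ≡⟨ cong (mc a ⊔_) (sym (⊔-assoc b (mc c) (suc j))) ⟩
  mc a ⊔ ((b ⊔ mc c) ⊔ suc j)         ≡⟨ sym (⊔-assoc (mc a) (b ⊔ mc c) (suc j)) ⟩
  mc a ⊔ (b ⊔ mc c) ⊔ suc j           ∎
  where open ≡-Reasoning

mc-split : ∀ {ζ α j} → Shaped ζ → split ζ ≡ (α , j) → mc ζ ≡ mc α ⊔ j
mc-split {α = α} {j} g eq = trans (cong mc (sym (proj₂ (proj₂ (split-parts g eq))))) (mc-addFin α j)

fsωh-Shaped : ∀ n (p : Σ OT (λ _ → ℕ)) {r} → LimTerm (proj₁ p) → Shaped (proj₁ p) →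
              Shaped r → Shaped (fsωh p r n)
fsωh-Shaped n (_ , zero) _ _ gr = ω-shaped gr (s≤s z≤n) 𝟎-shaped (λ _ → refl)
fsωh-Shaped zero (_ , suc _) _ _ _ = 𝟎-shaped
fsωh-Shaped (suc n) (l , suc j) lim gl _ =
  ω-shaped (Shaped-addFin j lim gl) (s≤s z≤n) 𝟎-shaped (λ _ → refl)

mutual
  []-Shaped : ∀ {α} n → Shaped α → Shaped (α [ n ])
  []-Shaped n 𝟎-shaped = 𝟎-shaped
  []-Shaped {ω^ a · b + (ω^ _ · _ + _)} n (ω-shaped ga b≥1 gc c≡𝟎) =
    ω-shaped ga b≥1 ([]-Shaped n gc) (λ a≡𝟎 → case c≡𝟎 a≡𝟎 of λ ())
  []-Shaped {ω^ a · suc zero + 𝟎} n (ω-shaped ga _ _ _) = fsω-Shaped n ga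
  []-Shaped {ω^ a · suc (suc b) + 𝟎} n (ω-shaped ga _ _ _) =
    ω-shaped ga (s≤s z≤n) (fsω-Shaped n ga) (λ { refl → refl })

  fsω-Shaped : ∀ {a} n → Shaped a → Shaped (fsω a n)
  fsω-Shaped {𝟎} n _ = 𝟎-shaped
  fsω-Shaped {a@(ω^ _ · _ + _)} n ga =
    fsωh-Shaped n (split a) (split₁-LimTerm a) (split₁-Shaped ga) ([]-Shaped n ga)

n≤mc-ωmul : ∀ e n → n ≤ mc (ωmul e n)
n≤mc-ωmul e zero = z≤n
n≤mc-ωmul e (suc n) = m≤n⊔m (mc e) (suc n)

mutual
  n≤mc-[] : ∀ {α} n → Shaped α → LimTerm α → α ≢ 𝟎 → n ≤ mc (α [ n ])
  n≤mc-[] n 𝟎-shaped 𝟎-lim α≢𝟎 = ⊥-elim (α≢𝟎 refl)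
  n≤mc-[] {ω^ E · b + (ω^ _ · _ + _)} n (ω-shaped _ _ gc _) (ω-lim lim) _ =
    m≤n⇒m≤o⊔n (mc E) (m≤n⇒m≤o⊔n b (n≤mc-[] n gc lim λ ()))
  n≤mc-[] {ω^ E@(ω^ _ · _ + _) · suc zero + 𝟎} n (ω-shaped gE _ _ _) _ _ =
    n≤mc-fsω n gE λ ()
  n≤mc-[] {ω^ E@(ω^ _ · _ + _) · suc (suc b) + 𝟎} n (ω-shaped gE _ _ _) _ _ =
    m≤n⇒m≤o⊔n (mc E) (m≤n⇒m≤o⊔n (suc b) (n≤mc-fsω n gE λ ()))

  n≤mc-fsω : ∀ {e} n → Shaped e → e ≢ 𝟎 → n ≤ mc (fsω e n)
  n≤mc-fsω {𝟎} n _ e≢𝟎 = ⊥-elim (e≢𝟎 refl)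
  n≤mc-fsω {e@(ω^ _ · _ + _)} n ge _ with split e in eq
  ... | l , zero = m≤n⇒m≤n⊔o 1 (n≤mc-[] n ge lim-e λ ())
    where
    lim-e : LimTerm e
    lim-e with split-parts ge eq
    ... | lim , _ , l≡e = subst LimTerm l≡e lim
  ... | l , suc j = n≤mc-ωmul (addFin l j) n

mutual
  A-det : ∀ {k ζ v v'} → A k ζ v → A k ζ v' → v ≡ v'
  A-det (A-fin e) (A-fin e') with trans (sym e) e'
  ... | refl = refl
  A-det (A-fin e) (A-inf e' α≢𝟎 _) with trans (sym e) e'
  ... | refl = ⊥-elim (α≢𝟎 refl)
  A-det (A-inf e α≢𝟎 _) (A-fin e') with trans (sym e) e'
  ... | refl = ⊥-elim (α≢𝟎 refl)
  A-det (A-inf _ _ it) (A-inf _ _ it') = Ait-det it it'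

  Ait-det : ∀ {k ζ i m m'} → Ait k ζ i m → Ait k ζ i m' → m ≡ m'
  Ait-det (it0-succ e a) (it0-succ e' a') with trans (sym e) e'
  ... | refl = A-det a a'
  Ait-det (it0-succ e _) (it0-lim e') with trans (sym e) e'
  ... | ()
  Ait-det (it0-lim e) (it0-succ e' _) with trans (sym e) e'
  ... | ()
  Ait-det (it0-lim _) (it0-lim _) = refl
  Ait-det (it-suc e it a) (it-suc e' it' a') with trans (sym e) e' | Ait-det it it'
  ... | refl | refl = A-det a a'

⊔-suc-≤ : ∀ x c {m} → x ⊔ c < m → x ⊔ suc c ≤ m
⊔-suc-≤ x c lt = ⊔-lub (m⊔n≤o⇒m≤o x c (<⇒≤ lt)) (≤-trans (s≤s (m≤n⊔m x c)) lt)

mutual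
  mc<A : ∀ {k ζ v} → 1 ≤ k → Shaped ζ → A k ζ v → mc ζ < v
  mc<A _ g (A-fin e) = s≤s (≤-reflexive (mc-split g e))
  mc<A {ζ = ζ} k≥1 g (A-inf e α≢𝟎 it) = <-≤-trans (m<m+n (mc ζ) k≥1) (mc+i≤Ait k≥1 g e α≢𝟎 it)

  mc+i≤Ait : ∀ {k ζ α b i m} → 1 ≤ k → Shaped ζ → split ζ ≡ (α , b) → α ≢ 𝟎 →
             Ait k ζ i m → mc ζ + i ≤ m
  mc+i≤Ait {ζ = ζ} {m = m} k≥1 g _ _ (it0-succ {α = α} {b = b} e a) with split-parts g e
  ... | lim , gα , _ = begin
    mc ζ + 0      ≡⟨ +-identityʳ (mc ζ) ⟩
    mc ζ          ≡⟨ mc-split g e ⟩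
    mc α ⊔ suc b  ≤⟨ ⊔-suc-≤ (mc α) b (subst (_< m) (mc-addFin α b) mc<m) ⟩
    m             ∎
    where
    open ≤-Reasoning
    mc<m = mc<A k≥1 (Shaped-addFin b lim gα) a
  mc+i≤Ait _ _ _ _ (it0-lim _) = ≤-reflexive (+-identityʳ _)
  mc+i≤Ait {ζ = ζ} {i = suc i} {m} k≥1 g e α≢𝟎 (it-suc e' it a) with trans (sym e) e'
  ... | refl with split-parts g e
  ...   | lim , gα , _ = subst (_≤ m) (sym (+-suc (mc ζ) i))
                           (≤-<-trans (mc+i≤Ait k≥1 g e α≢𝟎 it) (n<A[n] k≥1 gα lim α≢𝟎 a))

  n<A[n] : ∀ {k α n m} → 1 ≤ k → Shaped α → LimTerm α → α ≢ 𝟎 → A k (α [ n ]) m → n < m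
  n<A[n] {n = n} k≥1 gα lim α≢𝟎 a = ≤-<-trans (n≤mc-[] n gα lim α≢𝟎) (mc<A k≥1 ([]-Shaped n gα) a)

Ait-addFin-pred : ∀ {k ζ α c i m} → 1 ≤ k → Shaped α → LimTerm α → α ≢ 𝟎 →
                  split ζ ≡ (α , suc c) → Ait k ζ i m →
                  ∃ λ m' → A k (addFin α c) m' × m' + i ≤ m
Ait-addFin-pred _ _ _ _ e (it0-succ e' a) with trans (sym e) e'
... | refl = _ , a , ≤-reflexive (+-identityʳ _)
Ait-addFin-pred _ _ _ _ e (it0-lim e') with trans (sym e) e'
... | ()
Ait-addFin-pred {i = suc i} {m} k≥1 gα lim α≢𝟎 e (it-suc e' it a) with trans (sym e) e'
... | refl with Ait-addFin-pred k≥1 gα lim α≢𝟎 e it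
...   | m' , A' , m'+i≤ = m' , A' , subst (_≤ m) (sym (+-suc m' i))
                                      (≤-<-trans m'+i≤ (n<A[n] k≥1 gα lim α≢𝟎 a))

A-addFin-pred : ∀ {k α c m} → 1 ≤ k → LimTerm α → Shaped α → A k (addFin α (suc c)) m →
                ∃ λ m' → A k (addFin α c) m' × m' < m
A-addFin-pred {c = c} _ lim _ (A-fin e) with trans (sym e) (split-addFin (suc c) lim)
... | refl = _ , A-fin (split-addFin c 𝟎-lim) , ≤-refl
A-addFin-pred {c = c} k≥1 lim gα (A-inf e α≢𝟎 it) with trans (sym e) (split-addFin (suc c) lim)
... | refl with Ait-addFin-pred k≥1 gα lim α≢𝟎 e it
...   | m' , A' , m'+k≤m = m' , A' , <-≤-trans (m<m+n m' k≥1) m'+k≤m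

<ω^-tail-indep : ∀ {a b c c' e} → ω^ a · b + c <ₒ ω^ e · 1 + 𝟎 → ω^ a · b + c' <ₒ ω^ e · 1 + 𝟎
<ω^-tail-indep (exp< p) = exp< p
<ω^-tail-indep (coef< p) = coef< p
<ω^-tail-indep (rest< ())

addFin-<ω^ : ∀ {l x y z} c d → LimTerm l →
             addFin l c <ₒ ω^ (ω^ x · y + z) · 1 + 𝟎 → addFin l d <ₒ ω^ (ω^ x · y + z) · 1 + 𝟎
addFin-<ω^ _ zero 𝟎-lim _ = z<ω
addFin-<ω^ _ (suc d) 𝟎-lim _ = exp< z<ω
addFin-<ω^ {ω^ E · b + l} c d (ω-lim _) lt
  rewrite addFin-cons E b l c | addFin-cons E b l d = <ω^-tail-indep lt

WF-addFin : ∀ {α} c d → LimTerm α → WF (addFin α c) → WF (addFin α d)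
WF-addFin _ zero 𝟎-lim _ = wf𝟎
WF-addFin _ (suc d) 𝟎-lim _ = wfω wf𝟎 (s≤s z≤n) wf𝟎 z<ω
WF-addFin {ω^ E · b + l} c d (ω-lim lim) w
  rewrite addFin-cons E b l c | addFin-cons E b l d with w
... | wfω wE b≥1 wl lt = wfω wE b≥1 (WF-addFin c d lim wl) (addFin-<ω^ c d lim lt)

<ₒ-addFin-suc : ∀ {u α} c → WF u → LimTerm α → u <ₒ addFin α (suc c) → u ≤ₒ addFin α c
<ₒ-addFin-suc zero _ 𝟎-lim z<ω = inj₂ refl
<ₒ-addFin-suc (suc c) _ 𝟎-lim z<ω = inj₁ z<ω
<ₒ-addFin-suc c (wfω _ b≥1 wd d<ω^𝟎) 𝟎-lim (coef< b<1+c)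
  with <ω^𝟎⇒≡𝟎 wd d<ω^𝟎
... | refl = finite-pred c b≥1 b<1+c
  where
  finite-pred : ∀ {b} c → 1 ≤ b → b < suc c → ω^ 𝟎 · b + 𝟎 ≤ₒ addFin 𝟎 c
  finite-pred zero b≥1 (s≤s b≤0) with ≤-trans b≥1 b≤0
  ... | ()
  finite-pred (suc c) _ (s≤s b≤1+c) with m≤n⇒m<n∨m≡n b≤1+c
  ... | inj₁ b<1+c = inj₁ (coef< b<1+c)
  ... | inj₂ refl = inj₂ refl
<ₒ-addFin-suc {u} {ω^ E · b + l} c wu (ω-lim lim) u<
  rewrite addFin-cons E b l c = below wu u<
  where
  below : ∀ {u} → WF u → u <ₒ ω^ E · b + addFin l (suc c) → u ≤ₒ ω^ E · b + addFin l c
  below _ z<ω = inj₁ z<ω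
  below _ (exp< p) = inj₁ (exp< p)
  below _ (coef< p) = inj₁ (coef< p)
  below (wfω _ _ wd _) (rest< p) with <ₒ-addFin-suc c wd lim p
  ... | inj₁ q = inj₁ (rest< q)
  ... | inj₂ q = inj₂ (cong (ω^ E · b +_) q)

Cand-mono : ∀ {k m m' a ζ} → m' ≤ m → Cand k m' a ζ → Cand k m a ζ
Cand-mono m'≤m (wζ , (v , Aζ , v≤m') , a≤) = wζ , (v , Aζ , ≤-trans v≤m' m'≤m) , a≤

IsMax-restrict : ∀ {k m m' a ζ} → m' ≤ m → Cand k m' a ζ → IsMax (Cand k m a) ζ →
                 IsMax (Cand k m' a) ζ
IsMax-restrict m'≤m cand (_ , max) = cand , λ z → max z ∘ Cand-mono m'≤m

IsMax-pred : ∀ {k m m' a ξ ξ′} → A k ξ m → A k ξ′ m' → m' < m →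
             (∀ u → WF u → u <ₒ ξ → u ≤ₒ ξ′) → WF ξ′ → a ≤ mc ξ′ →
             IsMax (Cand k m a) ξ → IsMax (Cand k m' a) ξ′
IsMax-pred {k} {m' = m'} {a} {ξ′ = ξ′} Aξ Aξ′ m'<m below wξ′ a≤ (_ , max) =
  (wξ′ , (m' , Aξ′ , ≤-refl) , a≤) , bounded
  where
  bounded : ∀ z → Cand k m' a z → z ≤ₒ ξ′
  bounded z cand@(wz , (v , Az , v≤m') , _) with max z (Cand-mono (<⇒≤ m'<m) cand)
  ... | inj₁ z<ξ = below z wz z<ξ
  ... | inj₂ refl = ⊥-elim (<⇒≱ m'<m (subst (_≤ m') (A-det Az Aξ) v≤m'))

update : (ℕ → OT) → ℕ → OT → ℕ → OT
update s n y i with i ≟ n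
... | yes _ = y
... | no  _ = s i

update-≡ : ∀ s n y → update s n y n ≡ y
update-≡ s n y with n ≟ n
... | yes _ = refl
... | no n≢n = ⊥-elim (n≢n refl)

update-≢ : ∀ s {n} y {i} → i ≢ n → update s n y i ≡ s i
update-≢ s {n} y {i} i≢n with i ≟ n
... | yes i≡n = ⊥-elim (i≢n i≡n)
... | no  _ = refl

IsNFSeq-𝟎 : ∀ {k m} → IsNFSeq k m 0 (λ _ → 𝟎) 𝟎
IsNFSeq-𝟎 = refl , refl , λ _ ()

IsNFSeq-snoc : ∀ {k m n s x y} → IsNFSeq k m n s x → NFStep k m x y →
               IsNFSeq k m (suc n) (update s (suc n) y) y
IsNFSeq-snoc {k} {m} {n} {s} {y = y} (s0≡𝟎 , sn≡x , steps) step =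
  trans (update-≢ s {suc n} y λ ()) s0≡𝟎 , update-≡ s (suc n) y , steps′
  where
  s′ = update s (suc n) y
  steps′ : ∀ i → i < suc n → NFStep k m (s′ i) (s′ (suc i))
  steps′ i i<1+n with i ≟ n
  ... | yes refl = subst₂ (NFStep k m) (sym (trans (update-≢ s y (1+n≢n ∘ sym)) sn≡x))
                                       (sym (update-≡ s (suc n) y)) step
  ... | no i≢n = subst₂ (NFStep k m) (sym (update-≢ s y (<⇒≢ i<1+n)))
                                     (sym (update-≢ s y (i≢n ∘ suc-injective)))
                                     (steps i (≤∧≢⇒< (s≤s⁻¹ i<1+n) i≢n))

-- Each earlier ξ_{i+1} stays maximal for the bound m', since 𝔸 increases along
-- the sequence and so 𝔸(ξ_{i+1}) ≤ 𝔸(ξ_p) < m'.  A step with target 0 need not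
-- survive the change of bound; there the new sequence simply starts afresh.
NFSeq-reroute : ∀ {k m m'} → 1 ≤ k → m' ≤ m → (p : ℕ) (seq : ℕ → OT) {a : ℕ} {P : OT} →
                seq 0 ≡ 𝟎 →
                (∀ i → i < p → NFStep k m (seq i) (seq (suc i))) →
                A k (seq p) a → a < m' → IsMax (Cand k m' a) P →
                ∃₂ λ n seq′ → IsNFSeq k m' n seq′ P
NFSeq-reroute _ _ zero _ s0≡𝟎 _ Aa _ maxP =
  1 , _ , IsNFSeq-snoc IsNFSeq-𝟎 (_ , subst (λ t → A _ t _) s0≡𝟎 Aa , inj₁ maxP)
NFSeq-reroute {k} {m' = m'} k≥1 m'≤m (suc q) seq {a} s0≡𝟎 steps Aa a<m' maxP
  with steps q ≤-refl
... | _ , _ , inj₂ (_ , y≡𝟎) =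
  1 , _ , IsNFSeq-snoc IsNFSeq-𝟎 (_ , subst (λ t → A k t a) y≡𝟎 Aa , inj₁ maxP)
... | aq , Aq , inj₁ maxY@((wy , _ , aq≤mc) , _)
  with NFSeq-reroute k≥1 m'≤m q seq s0≡𝟎 (λ i i<q → steps i (m<n⇒m<1+n i<q)) Aq aq<m'
         (IsMax-restrict m'≤m (wy , (a , Aa , <⇒≤ a<m') , aq≤mc) maxY)
  where
  aq<m' : aq < m'
  aq<m' = <-trans (≤-<-trans aq≤mc (mc<A k≥1 (WF⇒Shaped wy) Aa)) a<m'
...   | n , seq′ , nfseq = suc n , _ , IsNFSeq-snoc nfseq (a , Aa , inj₁ maxP)

addFin-InNF : ∀ {k m α c a} (p : ℕ) (seq : ℕ → OT) → 1 ≤ k → LimTerm α →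
              WF (addFin α (suc c)) → A k (addFin α (suc c)) m → seq 0 ≡ 𝟎 →
              (∀ i → i < p → NFStep k m (seq i) (seq (suc i))) → A k (seq p) a →
              IsMax (Cand k m a) (addFin α (suc c)) → a ≤ mc (addFin α c) →
              InNF k (addFin α c)
addFin-InNF {c = c} p seq k≥1 lim wξ Aξ s0≡𝟎 steps Aa maxξ a≤
  with A-addFin-pred k≥1 lim (WF⇒Shaped (WF-addFin (suc c) 0 lim wξ)) Aξ
... | m' , Apred , m'<m = m' , Apred ,
  NFSeq-reroute k≥1 (<⇒≤ m'<m) p seq s0≡𝟎 steps Aa a<m'
    (IsMax-pred Aξ Apred m'<m (λ u wu → <ₒ-addFin-suc c wu lim) wpred a≤ maxξ)
  where
  wpred = WF-addFin (suc c) c lim wξ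
  a<m' = ≤-<-trans a≤ (mc<A k≥1 (WF⇒Shaped wpred) Apred)

mc-addFin-squeeze : ∀ {a} α c → a ≤ mc (addFin α (suc c)) → ¬ a ≤ mc (addFin α c) →
                    a ≡ suc c × mc α < a
mc-addFin-squeeze {a} α c a≤ a≰ = a≡1+c , mcα<a
  where
  mcα⊔c<a : mc α ⊔ c < a
  mcα⊔c<a = subst (_< a) (mc-addFin α c) (≰⇒> a≰)
  mcα<a = ≤-<-trans (m≤m⊔n (mc α) c) mcα⊔c<a
  a≡1+c : a ≡ suc c
  a≡1+c with ⊔-sel (mc α) (suc c) | subst (a ≤_) (mc-addFin α (suc c)) a≤
  ... | inj₁ ≡mcα | a≤⊔ = ⊥-elim (<⇒≱ mcα<a (subst (a ≤_) ≡mcα a≤⊔))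
  ... | inj₂ ≡1+c | a≤⊔ = ≤-antisym (subst (a ≤_) ≡1+c a≤⊔) (≤-<-trans (m≤n⊔m (mc α) c) mcα⊔c<a)

lemma5p3 : (k : ℕ) → 2 ≤ k → (ξ : OT) → WF ξ → IsSucc ξ →
    (m : ℕ) → A k ξ m → (n : ℕ) → (seq : ℕ → OT) → IsNFSeq k m n seq ξ →
    InNF k (pred₀ ξ)
    ⊎ (∃ λ α → ∃ λ a → A k (seq (pred n)) a × WF α × IsLimOrZero α ×
         ξ ≡ addFin α a × mc α < a)
lemma5p3 k k≥2 ξ wξ ξ-succ m Aξ zero seq (s0≡𝟎 , s0≡ξ , _) =
  ⊥-elim (ξ-succ (cong finPart (trans (sym s0≡ξ) s0≡𝟎)))
lemma5p3 k k≥2 ξ wξ ξ-succ m Aξ (suc p) seq (s0≡𝟎 , sn≡ξ , steps)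
  with succ-decompose (WF⇒Shaped wξ) ξ-succ | steps p ≤-refl
... | _ , _ , _ , refl | _ , _ , inj₂ (_ , sn≡𝟎) =
  ⊥-elim (ξ-succ (cong finPart (trans (sym sn≡ξ) sn≡𝟎)))
... | α , c , lim , refl | a , Aa , inj₁ maxsn with subst (IsMax (Cand k m a)) sn≡ξ maxsn
...   | maxξ@((_ , _ , a≤mcξ) , _) with a ≤? mc (addFin α c)
...     | yes a≤ = inj₁ (subst (InNF k) (sym (pred₀-addFin c lim))
    (addFin-InNF p seq (<⇒≤ k≥2) lim wξ Aξ s0≡𝟎 (λ i i<p → steps i (m<n⇒m<1+n i<p)) Aa maxξ a≤))
...     | no a≰ with mc-addFin-squeeze α c a≤mcξ a≰
...       | a≡1+c , mcα<a =
  inj₂ (α , a , Aa , WF-addFin (suc c) 0 lim wξ , LimTerm⇒IsLimOrZero lim ,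
        cong (addFin α) (sym a≡1+c) , mcα<a)
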